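{- Let $\mathcal{T}$ be a BSTSO instance in which every tree has $2$, $3$ or $4$ elements, and let $\mathcal{T}^{\supsetneq 3}:=\{T\in\mathcal{T}: |T|=4 \text{ and there is } T'\in\mathcal{T} \text{ with } |T'|=3,\ T'\subsetneq T\}$. Then $$\mathrm{opt}(\mathcal{T})=\mathrm{opt}(\mathcal{T}\setminus\mathcal{T}^{\supsetneq 3})+|\mathcal{T}^{\supsetneq 3}|.$$
   Context: BSTSO: Fix an associative, commutative binary operator $\circ$ on $\{0,1\}$. An instance is a finite family $\mathcal{T}$ of subsets of $\{1,\dots,n\}$ (trees). A circuit is a directed acyclic graph with inputs (in-degree $0$, each associated with a variable $x_i$) and gates (in-degree $2$); each vertex $v$ has a variable set $S(v)$, with $S(v)=\{i\}$ for the input of $x_i$ and, for a gate with predecessors $u,w$, $S(u)\cap S(w)=\emptyset$ and $S(v)=S(u)\cup S(w)$ (the gate computes $\bigcirc_{i\in S(v)}x_i$). A solution for $\mathcal{T}$ is a circuit in which every $T\in\mathcal{T}$ equals $S(v)$ for some vertex $v$; its size is its number of gates; $\mathrm{opt}(\mathcal{T})$ denotes the minimum size of a solution. -}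

module Defs where

open import Data.Nat using (ℕ; zero; suc; _+_; _≤_; _≟_)
open import Data.Fin using (Fin; zero; suc)
open import Data.Fin.Subset using (Subset; ⁅_⁆; _∪_; _∩_; Empty; _⊂_; ∣_∣)
open import Data.Fin.Subset.Properties using (_⊂?_)
open import Data.List using (List; filter; length)
open import Data.List.Relation.Unary.All using (All)
open import Data.List.Relation.Unary.Any using (Any; any?)
open import Data.Product using (Σ; ∃; _×_; _,_)
open import Data.Unit using (⊤)
open import Relation.Binary.PropositionalEquality using (_≡_)
open import Relation.Nullary using (Dec; ¬_)
open import Relation.Nullary.Decidable using (_×-dec_)

-- A circuit over variables x_1..x_n (indexed by Fin n) with m vertices,
-- listed in topological order.  The most recently added vertex has index
-- zero; older vertices are shifted by suc.
data Circuit (n : ℕ) : ℕ → Set where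
  empty    : Circuit n 0
  addInput : ∀ {m} → Circuit n m → Fin n → Circuit n (suc m)
  addGate  : ∀ {m} → Circuit n m → Fin m → Fin m → Circuit n (suc m)

varSet : ∀ {n m} → Circuit n m → Fin m → Subset n
varSet (addInput c i) zero    = ⁅ i ⁆
varSet (addInput c i) (suc v) = varSet c v
varSet (addGate c u w) zero    = varSet c u ∪ varSet c w
varSet (addGate c u w) (suc v) = varSet c v

Valid : ∀ {n m} → Circuit n m → Set
Valid empty           = ⊤
Valid (addInput c i)  = Valid c
Valid (addGate c u w) = Valid c × Empty (varSet c u ∩ varSet c w)

size : ∀ {n m} → Circuit n m → ℕ
size empty           = 0
size (addInput c i)  = size c
size (addGate c u w) = suc (size c)

Instance : ℕ → Set
Instance n = List (Subset n)

Solves : ∀ {n m} → Circuit n m → Instance n → Set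
Solves {m = m} c 𝒯 = All (λ T → Σ (Fin m) (λ v → varSet c v ≡ T)) 𝒯

IsSolution : ∀ {n m} → Instance n → Circuit n m → Set
IsSolution 𝒯 c = Valid c × Solves c 𝒯

IsOpt : ∀ {n} → Instance n → ℕ → Set
IsOpt {n} 𝒯 k =
  (Σ ℕ λ m → Σ (Circuit n m) λ c → IsSolution 𝒯 c × size c ≡ k)
  × (∀ m (c : Circuit n m) → IsSolution 𝒯 c → k ≤ size c)

InSup3 : ∀ {n} → Instance n → Subset n → Set
InSup3 𝒯 T = (∣ T ∣ ≡ 4) × Any (λ T′ → (∣ T′ ∣ ≡ 3) × (T′ ⊂ T)) 𝒯

inSup3? : ∀ {n} (𝒯 : Instance n) (T : Subset n) → Dec (InSup3 𝒯 T)
inSup3? 𝒯 T = (∣ T ∣ ≟ 4) ×-dec any? (λ T′ → (∣ T′ ∣ ≟ 3) ×-dec (T′ ⊂? T)) 𝒯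

sup3 : ∀ {n} → Instance n → Instance n
sup3 𝒯 = filter (inSup3? 𝒯) 𝒯

withoutSup3 : ∀ {n} → Instance n → Instance n
withoutSup3 𝒯 = filter (λ T → Relation.Nullary.¬? (inSup3? 𝒯 T)) 𝒯
  where import Relation.Nullary

{-# OPTIONS --safe #-}
module Submission where

-- Upper bound: every T ∈ 𝒯^{⊋3} is T′ ∪ {j} with T′ a 3-set of 𝒯 ∖ 𝒯^{⊋3}, so a solution
-- for 𝒯 ∖ 𝒯^{⊋3} grows into one for 𝒯 by one new input x_j and one gate per such T.
-- Lower bound: remove the trees T ∈ 𝒯^{⊋3} from a solution for 𝒯 one at a time, deleting
-- every gate whose set is T or has more than four elements.  The children of a surviving
-- gate are proper subsets of a set with at most four elements, so they survive too; every
-- other tree survives, and the gate computing T is gone.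
-- Existence of opt: every solution can be rebuilt, gate for gate, on top of the circuit
-- of the n inputs, and whether that circuit extends to a solution with g more gates is a
-- finite search, so a least such g can be found.

open import Defs
import Data.Bool as Bool
open import Data.Empty using (⊥-elim)
open import Data.Fin using (Fin; zero; suc)
open import Data.Fin.Properties using (any?)
open import Data.Fin.Subset
  using (Subset; ∣_∣; _∪_; _∩_; ⁅_⁆; ⋃; Empty; Nonempty; _∈_; _∉_; _⊆_; _⊂_; _⊃_)
open import Data.Fin.Subset.Properties
open import Data.List using (List; []; _∷_; length; map; filter; allFin)
open import Data.List.Membership.Propositional using (find)
  renaming (_∈_ to _∈ˡ_; _∉_ to _∉ˡ_)
open import Data.List.Membership.Propositional.Properties using (∈-filter⁺; ∈-filter⁻; ∈-allFin)
open import Data.List.Relation.Unary.All as All using (All; []; _∷_)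
import Data.List.Relation.Unary.All.Properties as All
open import Data.List.Relation.Unary.Any using (here; there)
open import Data.List.Relation.Unary.AllPairs using (_∷_)
open import Data.List.Relation.Unary.Unique.Propositional using (Unique)
import Data.List.Relation.Unary.Unique.Propositional.Properties as Unique
open import Data.Nat using (ℕ; zero; suc; _+_; _≤_; _<_; z≤n; s≤s; _≤?_)
open import Data.Nat.Properties
open import Data.Product using (Σ; ∃; ∃₂; _×_; _,_; proj₁; proj₂)
open import Data.Sum using (_⊎_; inj₁; inj₂)
open import Data.Unit using (tt)
open import Data.Vec.Properties using (≡-dec)
open import Function using (_∘_)
open import Relation.Binary.Definitions using (_Respects_)
open import Relation.Binary.PropositionalEquality
open import Relation.Nullary using (Dec; yes; no; ¬_; ¬?)
open import Relation.Nullary.Decidable using (_×-dec_)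
open import Relation.Unary using (Decidable)

private
  variable
    n m m₁ : ℕ
    x : Fin n
    p q : Subset n

x∉p⇒Empty[⁅x⁆∩p] : x ∉ p → Empty (⁅ x ⁆ ∩ p)
x∉p⇒Empty[⁅x⁆∩p] {x = x} {p = p} x∉p (z , z∈⁅x⁆∩p) with x∈p∩q⁻ ⁅ x ⁆ p z∈⁅x⁆∩p
... | z∈⁅x⁆ , z∈p = x∉p (subst (_∈ p) (x∈⁅y⁆⇒x≡y x z∈⁅x⁆) z∈p)

p⊂p∪q : Nonempty q → Empty (p ∩ q) → p ⊂ p ∪ q
p⊂p∪q {q = q} (z , z∈q) disjoint =
  p⊆p∪q q , z , x∈p∪q⁺ (inj₂ z∈q) , λ z∈p → disjoint (z , x∈p∩q⁺ (z∈p , z∈q))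

q⊂p∪q : Nonempty p → Empty (p ∩ q) → q ⊂ p ∪ q
q⊂p∪q {p = p} {q = q} (z , z∈p) disjoint =
  q⊆p∪q p q , z , x∈p∪q⁺ (inj₁ z∈p) , λ z∈q → disjoint (z , x∈p∩q⁺ (z∈p , z∈q))

p⊆q∧∣q∣≤∣p∣⇒p≡q : p ⊆ q → ∣ q ∣ ≤ ∣ p ∣ → p ≡ q
p⊆q∧∣q∣≤∣p∣⇒p≡q {p = p} p⊆q ∣q∣≤∣p∣ = ⊆-antisym p⊆q q⊆p
  where
  q⊆p : _ ⊆ p
  q⊆p {z} z∈q with z ∈? p
  ... | yes z∈p = z∈p
  ... | no  z∉p = ⊥-elim (<⇒≱ (p⊂q⇒∣p∣<∣q∣ (p⊆q , z , z∈q , z∉p)) ∣q∣≤∣p∣)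

0<∣p∣⇒Nonempty : 0 < ∣ p ∣ → Nonempty p
0<∣p∣⇒Nonempty {n} {p} 0<∣p∣ with nonempty? p
... | yes ne  = ne
... | no  ¬ne = ⊥-elim (<⇒≢ 0<∣p∣ (sym (trans (cong ∣_∣ (Empty-unique ¬ne)) (∣⊥∣≡0 n))))

_⋖_ : Subset n → Subset n → Set
p ⋖ q = p ⊂ q × suc ∣ p ∣ ≡ ∣ q ∣

⋖⇒≡⁅⁆∪ : p ⋖ q → ∃ λ x → x ∉ p × q ≡ ⁅ x ⁆ ∪ p
⋖⇒≡⁅⁆∪ {p = p} {q = q} ((p⊆q , x , x∈q , x∉p) , 1+∣p∣≡∣q∣) =
  x , x∉p , sym (p⊆q∧∣q∣≤∣p∣⇒p≡q x∪p⊆q ∣q∣≤∣x∪p∣)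
  where
  x∪p⊆q : ⁅ x ⁆ ∪ p ⊆ q
  x∪p⊆q {z} z∈x∪p with x∈p∪q⁻ ⁅ x ⁆ p z∈x∪p
  ... | inj₁ z∈⁅x⁆ = subst (_∈ q) (sym (x∈⁅y⁆⇒x≡y x z∈⁅x⁆)) x∈q
  ... | inj₂ z∈p   = p⊆q z∈p
  ∣q∣≤∣x∪p∣ : ∣ q ∣ ≤ ∣ ⁅ x ⁆ ∪ p ∣
  ∣q∣≤∣x∪p∣ = subst (_≤ _) 1+∣p∣≡∣q∣
    (p⊂q⇒∣p∣<∣q∣ (q⊂p∪q (x , x∈⁅x⁆ x) (x∉p⇒Empty[⁅x⁆∩p] x∉p)))

x∈⋃⁅xs⁆⇒x∈xs : ∀ xs → x ∈ ⋃ (map ⁅_⁆ xs) → x ∈ˡ xs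
x∈⋃⁅xs⁆⇒x∈xs []       x∈⊥ = ⊥-elim (∉⊥ x∈⊥)
x∈⋃⁅xs⁆⇒x∈xs (y ∷ xs) x∈  with x∈p∪q⁻ ⁅ y ⁆ (⋃ (map ⁅_⁆ xs)) x∈
... | inj₁ x∈⁅y⁆ = here (x∈⁅y⁆⇒x≡y y x∈⁅y⁆)
... | inj₂ x∈⋃   = there (x∈⋃⁅xs⁆⇒x∈xs xs x∈⋃)

x∈xs⇒x∈⋃⁅xs⁆ : ∀ {xs} → x ∈ˡ xs → x ∈ ⋃ (map ⁅_⁆ xs)
x∈xs⇒x∈⋃⁅xs⁆ (here refl) = x∈p∪q⁺ (inj₁ (x∈⁅x⁆ _))
x∈xs⇒x∈⋃⁅xs⁆ (there x∈) = x∈p∪q⁺ (inj₂ (x∈xs⇒x∈⋃⁅xs⁆ x∈))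

elements : Subset n → List (Fin n)
elements {n} p = filter (_∈? p) (allFin n)

p≡⋃⁅elements⁆ : ∀ (p : Subset n) → p ≡ ⋃ (map ⁅_⁆ (elements p))
p≡⋃⁅elements⁆ {n} p = ⊆-antisym
  (λ {z} z∈p → x∈xs⇒x∈⋃⁅xs⁆ (∈-filter⁺ (_∈? p) (∈-allFin z) z∈p))
  (λ z∈⋃ → proj₂ (∈-filter⁻ (_∈? p) {xs = allFin n} (x∈⋃⁅xs⁆⇒x∈xs _ z∈⋃)))

Computes : Circuit n m → Subset n → Set
Computes {m = m} c S = Σ (Fin m) λ v → varSet c v ≡ S

Covers : Circuit n m → Set
Covers {n} c = ∀ (i : Fin n) → Computes c ⁅ i ⁆

HasSolutionOfSize : Instance n → ℕ → Set
HasSolutionOfSize {n} I k = ∃₂ λ m (c : Circuit n m) → IsSolution I c × size c ≡ k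

_⊑_ : Circuit n m → Circuit n m₁ → Set
c ⊑ d = ∀ {S} → Computes c S → Computes d S

⊑-addInput : ∀ {c : Circuit n m} {i} → c ⊑ addInput c i
⊑-addInput (v , v↦) = suc v , v↦

⊑-addGate : ∀ {c : Circuit n m} {u w} → c ⊑ addGate c u w
⊑-addGate (v , v↦) = suc v , v↦

varSet-nonempty : ∀ (c : Circuit n m) v → Nonempty (varSet c v)
varSet-nonempty (addInput c i)  zero    = i , x∈⁅x⁆ i
varSet-nonempty (addInput c i)  (suc v) = varSet-nonempty c v
varSet-nonempty (addGate c u w) zero    =
  let z , z∈ = varSet-nonempty c u in z , x∈p∪q⁺ (inj₁ z∈)
varSet-nonempty (addGate c u w) (suc v) = varSet-nonempty c v

valid? : ∀ (c : Circuit n m) → Dec (Valid c)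
valid? empty           = yes tt
valid? (addInput c i)  = valid? c
valid? (addGate c u w) = valid? c ×-dec ¬? (nonempty? (varSet c u ∩ varSet c w))

computes? : ∀ (c : Circuit n m) → Decidable (Computes c)
computes? c S = any? λ v → ≡-dec Bool._≟_ (varSet c v) S

isSolution? : ∀ (I : Instance n) (c : Circuit n m) → Dec (IsSolution I c)
isSolution? I c = valid? c ×-dec All.all? (computes? c) I

adjoin : Circuit n m → Fin m → Fin n → Circuit n (2 + m)
adjoin c v x = addGate (addInput c x) zero (suc v)

⊑-adjoin : ∀ {c : Circuit n m} {v x} → c ⊑ adjoin c v x
⊑-adjoin (v , v↦) = suc (suc v) , v↦

record Extension (c : Circuit n m) (S : Subset n) : Set where
  constructor extension
  field
    {m′}     : ℕ
    circuit  : Circuit n m′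
    valid    : Valid circuit
    extends  : c ⊑ circuit
    computes : Computes circuit S

realise : ∀ (c : Circuit n m) → Valid c → ∀ x xs → Unique (x ∷ xs) →
          Extension c (⋃ (map ⁅_⁆ (x ∷ xs)))
realise c vc x [] _ = extension (addInput c x) vc ⊑-addInput (zero , sym (∪-identityʳ ⁅ x ⁆))
realise c vc x (y ∷ ys) (x∉y∷ys ∷ unique) with realise c vc y ys unique
... | extension d vd c⊑d (v , v↦) =
  extension (adjoin d v x) (vd , subst (Empty ∘ (⁅ x ⁆ ∩_)) (sym v↦) x∩⋃≡∅)
            (⊑-adjoin ∘ c⊑d) (zero , cong (⁅ x ⁆ ∪_) v↦)
  where
  x∩⋃≡∅ : Empty (⁅ x ⁆ ∩ ⋃ (map ⁅_⁆ (y ∷ ys)))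
  x∩⋃≡∅ = x∉p⇒Empty[⁅x⁆∩p] (All.All¬⇒¬Any x∉y∷ys ∘ x∈⋃⁅xs⁆⇒x∈xs (y ∷ ys))

realise-nonempty : ∀ (c : Circuit n m) {S} → Valid c → Nonempty S → Extension c S
realise-nonempty {n} c {S} vc (z , z∈S) =
  subst (Extension c) (sym (p≡⋃⁅elements⁆ S))
    (from-list (elements S) (Unique.filter⁺ (_∈? S) (Unique.allFin⁺ n))
               (∈-filter⁺ (_∈? S) (∈-allFin z) z∈S))
  where
  from-list : ∀ xs → Unique xs → z ∈ˡ xs → Extension c (⋃ (map ⁅_⁆ xs))
  from-list (x ∷ xs) unique _ = realise c vc x xs unique

solution-exists : ∀ (I : Instance n) → All Nonempty I → ∃₂ λ m (c : Circuit n m) → IsSolution I c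
solution-exists []      []         = 0 , empty , tt , []
solution-exists (S ∷ I) (ne ∷ nes) with solution-exists I nes
... | _ , c , vc , solves with realise-nonempty c vc ne
... | extension d vd c⊑d computes = _ , d , vd , computes ∷ All.map c⊑d solves

inputs : ∀ k → (Fin k → Fin n) → Circuit n k
inputs zero    f = empty
inputs (suc k) f = addInput (inputs k (f ∘ suc)) (f zero)

inputs-valid : ∀ k (f : Fin k → Fin n) → Valid (inputs k f)
inputs-valid zero    f = tt
inputs-valid (suc k) f = inputs-valid k (f ∘ suc)

size-inputs : ∀ k (f : Fin k → Fin n) → size (inputs k f) ≡ 0
size-inputs zero    f = refl
size-inputs (suc k) f = size-inputs k (f ∘ suc)

inputs-computes : ∀ k (f : Fin k → Fin n) j → Computes (inputs k f) ⁅ f j ⁆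
inputs-computes (suc k) f zero    = zero , refl
inputs-computes (suc k) f (suc j) = ⊑-addInput (inputs-computes k (f ∘ suc) j)

data GrowsBy {n} : ∀ {m m₁} → ℕ → Circuit n m → Circuit n m₁ → Set where
  done : ∀ {m} {c : Circuit n m} → GrowsBy 0 c c
  step : ∀ {m m₁ g} {c : Circuit n m} {u w} {d : Circuit n m₁} →
         GrowsBy g (addGate c u w) d → GrowsBy (suc g) c d

growsBy-addGate : ∀ {g} {c : Circuit n m} {d : Circuit n m₁} {u w} →
                  GrowsBy g c d → GrowsBy (suc g) c (addGate d u w)
growsBy-addGate done      = step done
growsBy-addGate (step gr) = step (growsBy-addGate gr)

Completable : Instance n → Circuit n m → ℕ → Set
Completable I c zero    = IsSolution I c
Completable I c (suc g) = ∃₂ λ u w → Completable I (addGate c u w) g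

completable? : ∀ (I : Instance n) (c : Circuit n m) g → Dec (Completable I c g)
completable? I c zero    = isSolution? I c
completable? I c (suc g) = any? λ u → any? λ w → completable? I (addGate c u w) g

completable⇒solution : ∀ {I : Instance n} (c : Circuit n m) g →
                       Completable I c g → HasSolutionOfSize I (g + size c)
completable⇒solution c zero    solution       = _ , c , solution , refl
completable⇒solution c (suc g) (u , w , rest) =
  let m₁ , d , solution , size-d = completable⇒solution (addGate c u w) g rest
  in  m₁ , d , solution , trans size-d (+-suc g (size c))

growsBy⇒completable : ∀ {I : Instance n} {g} {c : Circuit n m} {d : Circuit n m₁} →
                      GrowsBy g c d → IsSolution I d → Completable I c g
growsBy⇒completable done                      solution = solution
growsBy⇒completable (step {u = u} {w = w} gr) solution = u , w , growsBy⇒completable gr solution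

record Normalisation (b : Circuit n m) (c : Circuit n m₁) : Set where
  constructor normalisation
  field
    {m′}      : ℕ
    circuit   : Circuit n m′
    grows     : GrowsBy (size c) b circuit
    valid     : Valid circuit
    covers    : Covers circuit
    simulates : c ⊑ circuit

normalise : ∀ {b : Circuit n m} → Valid b → Covers b → (c : Circuit n m₁) → Valid c →
            Normalisation b c
normalise {b = b} vb cb empty _ = normalisation b done vb cb λ ()
normalise vb cb (addInput c i) vc with normalise vb cb c vc
... | normalisation d grows vd cd c⊑d = normalisation d grows vd cd simulates
  where
  simulates : addInput c i ⊑ d
  simulates (zero  , refl) = cd i
  simulates (suc v , v↦)   = c⊑d (v , v↦)
normalise vb cb (addGate c u w) (vc , disjoint) with normalise vb cb c vc
... | normalisation d grows vd cd c⊑d with c⊑d (u , refl) | c⊑d (w , refl)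
...   | u′ , u↦ | w′ , w↦ =
  normalisation (addGate d u′ w′) (growsBy-addGate grows)
    (vd , subst Empty (sym (cong₂ _∩_ u↦ w↦)) disjoint) (⊑-addGate ∘ cd) simulates
  where
  simulates : addGate c u w ⊑ addGate d u′ w′
  simulates (zero  , refl) = zero , cong₂ _∪_ u↦ w↦
  simulates (suc v , v↦)   = ⊑-addGate (c⊑d (v , v↦))

least : ∀ {P : ℕ → Set} → Decidable P → ∀ {s} → P s → ∃ λ k → P k × (∀ {j} → P j → k ≤ j)
least P? p with P? 0
... | yes p₀ = 0 , p₀ , λ _ → z≤n
least P? {zero}  p | no ¬p₀ = ⊥-elim (¬p₀ p)
least P? {suc s} p | no ¬p₀ with least (P? ∘ suc) p
... | k , pk , minimal =
  suc k , pk , λ { {zero} p₀ → ⊥-elim (¬p₀ p₀) ; {suc j} pj → s≤s (minimal pj) }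

opt-exists : ∀ (I : Instance n) → All Nonempty I → Σ ℕ (IsOpt I)
opt-exists {n} I nes =
  let _ , c , solution        = solution-exists I nes
      k , completable , minimal = least (completable? I base) (completable-from c solution)
      k+0≡k = trans (cong (k +_) (size-inputs n _)) (+-identityʳ k)
  in  k , subst (HasSolutionOfSize I) k+0≡k (completable⇒solution base k completable)
        , λ _ c′ solution′ → minimal (completable-from c′ solution′)
  where
  base : Circuit n n
  base = inputs n (λ i → i)
  completable-from : ∀ {m} (c : Circuit n m) → IsSolution I c → Completable I base (size c)
  completable-from c (vc , solves)
    with normalise {b = base} (inputs-valid n _) (inputs-computes n _) c vc
  ... | normalisation d grows vd _ c⊑d = growsBy⇒completable {I = I} grows (vd , All.map c⊑d solves)

record Pruned (P : Subset n → Set) (c : Circuit n m) : Set where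
  constructor pruned
  field
    {m′}    : ℕ
    circuit : Circuit n m′
    valid   : Valid circuit
    keeps   : ∀ {S} → P S → Computes c S → Computes circuit S
    shrinks : size circuit ≤ size c
    drops   : ∀ {S} → ¬ P S → Computes c S → size circuit < size c

module _ {P : Subset n → Set} (P? : Decidable P) (P-⁅⁆ : ∀ i → P ⁅ i ⁆)
         (P-resp-⊃ : P Respects _⊃_) where

  prune : ∀ (c : Circuit n m) → Valid c → Pruned P c
  prune empty _ = pruned empty tt (λ _ ()) z≤n (λ _ ())
  prune (addInput c i) vc with prune c vc
  ... | pruned c′ vc′ keeps shrinks drops = pruned (addInput c′ i) vc′ keeps′ shrinks drops′
    where
    keeps′ : ∀ {S} → P S → Computes (addInput c i) S → Computes (addInput c′ i) S
    keeps′ _  (zero  , v↦) = zero , v↦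
    keeps′ pS (suc v , v↦) = ⊑-addInput (keeps pS (v , v↦))
    drops′ : ∀ {S} → ¬ P S → Computes (addInput c i) S → size c′ < size c
    drops′ ¬pS (zero  , v↦) = ⊥-elim (¬pS (subst P v↦ (P-⁅⁆ i)))
    drops′ ¬pS (suc v , v↦) = drops ¬pS (v , v↦)
  prune (addGate c u w) (vc , disjoint) with prune c vc | P? (varSet c u ∪ varSet c w)
  ... | pruned c′ vc′ keeps shrinks drops | no ¬pS =
    pruned c′ vc′ keeps′ (m≤n⇒m≤1+n shrinks) (λ _ _ → s≤s shrinks)
    where
    keeps′ : ∀ {S} → P S → Computes (addGate c u w) S → Computes c′ S
    keeps′ pS (zero  , refl) = ⊥-elim (¬pS pS)
    keeps′ pS (suc v , v↦)   = keeps pS (v , v↦)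
  ... | pruned c′ vc′ keeps shrinks drops | yes pS
    with keeps (P-resp-⊃ (p⊂p∪q (varSet-nonempty c w) disjoint) pS) (u , refl)
       | keeps (P-resp-⊃ (q⊂p∪q (varSet-nonempty c u) disjoint) pS) (w , refl)
  ...  | u′ , u↦ | w′ , w↦ =
    pruned (addGate c′ u′ w′) (vc′ , subst Empty (sym (cong₂ _∩_ u↦ w↦)) disjoint)
           keeps′ (s≤s shrinks) drops′
    where
    keeps′ : ∀ {S} → P S → Computes (addGate c u w) S → Computes (addGate c′ u′ w′) S
    keeps′ _  (zero  , refl) = zero , cong₂ _∪_ u↦ w↦
    keeps′ pS (suc v , v↦)   = ⊑-addGate (keeps pS (v , v↦))
    drops′ : ∀ {S} → ¬ P S → Computes (addGate c u w) S →
             size (addGate c′ u′ w′) < size (addGate c u w)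
    drops′ ¬pS (zero  , refl) = ⊥-elim (¬pS pS)
    drops′ ¬pS (suc v , v↦)   = s≤s (drops ¬pS (v , v↦))

Below : Subset n → Subset n → Set
Below T S = ∣ S ∣ ≤ ∣ T ∣ × S ≢ T

below? : ∀ (T : Subset n) → Decidable (Below T)
below? T S = (∣ S ∣ ≤? ∣ T ∣) ×-dec ¬? (≡-dec Bool._≟_ S T)

Below-⁅⁆ : ∀ {T : Subset n} → 1 < ∣ T ∣ → ∀ i → Below T ⁅ i ⁆
Below-⁅⁆ 1<∣T∣ i =
  subst (_≤ _) (sym (∣⁅x⁆∣≡1 i)) (<⇒≤ 1<∣T∣) ,
  λ ⁅i⁆≡T → <⇒≢ 1<∣T∣ (trans (sym (∣⁅x⁆∣≡1 i)) (cong ∣_∣ ⁅i⁆≡T))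

Below-resp-⊃ : ∀ {T : Subset n} → Below T Respects _⊃_
Below-resp-⊃ S′⊂S (∣S∣≤∣T∣ , _) =
  let ∣S′∣<∣T∣ = <-≤-trans (p⊂q⇒∣p∣<∣q∣ S′⊂S) ∣S∣≤∣T∣
  in  <⇒≤ ∣S′∣<∣T∣ , λ { refl → <-irrefl refl ∣S′∣<∣T∣ }

remove-trees : ∀ {k} → 1 < k → (L W : Instance n) → Unique L → All (λ T → ∣ T ∣ ≡ k) L →
               All (λ S → ∣ S ∣ ≤ k) W → All (_∉ˡ L) W →
               ∀ (c : Circuit n m) → Valid c → Solves c L → Solves c W →
               ∃₂ λ m′ (c′ : Circuit n m′) → IsSolution W c′ × size c′ + length L ≤ size c
remove-trees _ [] W _ _ _ _ c vc [] solves-W =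
  _ , c , (vc , solves-W) , ≤-reflexive (+-identityʳ (size c))
remove-trees 1<k (T ∷ L) W (T∉L ∷ unique) (∣T∣≡k ∷ ∣L∣≡k) ∣W∣≤k W∉T∷L
             c vc (computes-T ∷ solves-L) solves-W
  with prune (below? T) (Below-⁅⁆ (subst (1 <_) (sym ∣T∣≡k) 1<k)) Below-resp-⊃ c vc
... | pruned c₁ vc₁ keeps _ drops
  with remove-trees 1<k L W unique ∣L∣≡k ∣W∣≤k (All.map (_∘ there) W∉T∷L) c₁ vc₁
         (All.zipWith (λ (below , computes) → keeps below computes) (L-below , solves-L))
         (All.zipWith (λ (below , computes) → keeps below computes) (W-below , solves-W))
  where
  L-below : All (Below T) L
  L-below = All.zipWith
    (λ (∣S∣≡k , T≢S) → ≤-reflexive (trans ∣S∣≡k (sym ∣T∣≡k)) , T≢S ∘ sym) (∣L∣≡k , T∉L)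
  W-below : All (Below T) W
  W-below = All.zipWith
    (λ (∣S∣≤k , S∉T∷L) → subst (_ ≤_) (sym ∣T∣≡k) ∣S∣≤k , S∉T∷L ∘ here) (∣W∣≤k , W∉T∷L)
... | _ , c₂ , solution₂ , size-c₂ = _ , c₂ , solution₂ , (begin
  size c₂ + suc (length L) ≡⟨ +-suc (size c₂) (length L) ⟩
  suc (size c₂ + length L) ≤⟨ s≤s size-c₂ ⟩
  suc (size c₁)            ≤⟨ drops (λ (_ , T≢T) → T≢T refl) computes-T ⟩
  size c                   ∎)
  where open ≤-Reasoning

extend-by-covers : ∀ (c : Circuit n m) {L : Instance n} → Valid c →
                   All (λ T → ∃ λ S → Computes c S × S ⋖ T) L →
                   ∃₂ λ m′ (c′ : Circuit n m′) →
                     Valid c′ × c ⊑ c′ × Solves c′ L × size c′ ≡ length L + size c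
extend-by-covers c vc [] = _ , c , vc , (λ computes → computes) , [] , refl
extend-by-covers c vc ((S , computes-S , S⋖T) ∷ covers) with extend-by-covers c vc covers
... | _ , c₁ , vc₁ , c⊑c₁ , solves , size-c₁ with c⊑c₁ computes-S | ⋖⇒≡⁅⁆∪ S⋖T
...   | v , v↦ | x , x∉S , T≡x∪S =
  _ , adjoin c₁ v x , (vc₁ , subst (Empty ∘ (⁅ x ⁆ ∩_)) (sym v↦) (x∉p⇒Empty[⁅x⁆∩p] x∉S))
    , ⊑-adjoin ∘ c⊑c₁
    , (zero , trans (cong (⁅ x ⁆ ∪_) v↦) (sym T≡x∪S)) ∷ All.map ⊑-adjoin solves
    , cong suc size-c₁

module _ (𝒯 : Instance n) where

  sup3-∣∣≡4 : All (λ T → ∣ T ∣ ≡ 4) (sup3 𝒯)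
  sup3-∣∣≡4 = All.map proj₁ (All.all-filter (inSup3? 𝒯) 𝒯)

  withoutSup3-∉-sup3 : All (_∉ˡ sup3 𝒯) (withoutSup3 𝒯)
  withoutSup3-∉-sup3 =
    All.map (λ ¬inSup3 S∈ → ¬inSup3 (All.lookup (All.all-filter (inSup3? 𝒯) 𝒯) S∈))
            (All.all-filter (¬? ∘ inSup3? 𝒯) 𝒯)

  sup3-covered : ∀ (c : Circuit n m) → Solves c (withoutSup3 𝒯) →
                 All (λ T → ∃ λ S → Computes c S × S ⋖ T) (sup3 𝒯)
  sup3-covered c solves = All.map covered (All.all-filter (inSup3? 𝒯) 𝒯)
    where
    3≢4 : 3 ≢ 4
    3≢4 ()
    covered : ∀ {T} → InSup3 𝒯 T → ∃ λ S → Computes c S × S ⋖ T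
    covered (∣T∣≡4 , ∃S) with find ∃S
    ... | S , S∈𝒯 , ∣S∣≡3 , S⊂T =
      S , All.lookup solves (∈-filter⁺ (¬? ∘ inSup3? 𝒯) S∈𝒯 (λ (∣S∣≡4 , _) → 3≢4 (trans (sym ∣S∣≡3) ∣S∣≡4)))
        , S⊂T , trans (cong suc ∣S∣≡3) (sym ∣T∣≡4)

tree-size-bounds : ∀ {k} → (k ≡ 2) ⊎ (k ≡ 3) ⊎ (k ≡ 4) → 0 < k × k ≤ 4
tree-size-bounds (inj₁ refl)        = s≤s z≤n , s≤s (s≤s z≤n)
tree-size-bounds (inj₂ (inj₁ refl)) = s≤s z≤n , s≤s (s≤s (s≤s z≤n))
tree-size-bounds (inj₂ (inj₂ refl)) = s≤s z≤n , ≤-refl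

lemma6 : ∀ n (𝒯 : Instance n) → Unique 𝒯
    → All (λ T → (∣ T ∣ ≡ 2) ⊎ (∣ T ∣ ≡ 3) ⊎ (∣ T ∣ ≡ 4)) 𝒯
    → (Σ ℕ λ b → IsOpt (withoutSup3 𝒯) b)
      × (∀ b → IsOpt (withoutSup3 𝒯) b → IsOpt 𝒯 (b + length (sup3 𝒯)))
lemma6 n 𝒯 unique sizes =
  opt-exists W (to-W (All.map (0<∣p∣⇒Nonempty ∘ proj₁ ∘ tree-size-bounds) sizes)) ,
  λ b opt → upper b opt , lower b opt
  where
  W = withoutSup3 𝒯
  L = sup3 𝒯
  to-W : ∀ {P : Subset n → Set} → All P 𝒯 → All P W
  to-W = All.filter⁺ (¬? ∘ inSup3? 𝒯)
  upper : ∀ b → IsOpt W b → HasSolutionOfSize 𝒯 (b + length L)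
  upper b ((_ , c , (vc , solves-W) , refl) , _) with extend-by-covers c vc (sup3-covered 𝒯 c solves-W)
  ... | _ , c′ , vc′ , c⊑c′ , solves-L , size-c′ =
    _ , c′ , (vc′ , All.filter⁻ (inSup3? 𝒯) solves-L (All.map c⊑c′ solves-W))
      , trans size-c′ (+-comm (length L) b)
  lower : ∀ b → IsOpt W b → ∀ m (c : Circuit n m) → IsSolution 𝒯 c → b + length L ≤ size c
  lower b (_ , minimal) m c (vc , solves)
    with remove-trees (s≤s (s≤s z≤n)) L W (Unique.filter⁺ (inSup3? 𝒯) unique) (sup3-∣∣≡4 𝒯)
           (to-W (All.map (proj₂ ∘ tree-size-bounds) sizes)) (withoutSup3-∉-sup3 𝒯)
           c vc (All.filter⁺ (inSup3? 𝒯) solves) (to-W solves)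
  ... | m′ , c′ , solution′ , size-c′ =
    ≤-trans (+-monoˡ-≤ (length L) (minimal m′ c′ solution′)) size-c′
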